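{- For every integer $d\ge 1$, the automorphism group of $\vec{\mathcal B}(d,2)$ is isomorphic to $\mathrm{Sym}(\mathcal A_d)$.
   Context: $\mathcal A_d=\{0,1,\dots,d-1\}$. The directed de Bruijn graph $\vec{\mathcal B}(d,2)$ has vertex set $\mathcal A_d^2$ (strings $x_1x_2$ over $\mathcal A_d$) and an arc from $x_1x_2$ to $y_1y_2$ iff $x_2=y_1$. An automorphism of a directed graph is a permutation $\pi$ of the vertices such that $(u,v)$ is an arc iff $(\pi(u),\pi(v))$ is an arc. -}

module Defs where

open import Data.Nat using (ℕ)
open import Data.Fin using (Fin)
open import Data.Product using (_×_; proj₁; proj₂; Σ; ∃; _,_)
open import Function.Bundles using (_↔_; _⇔_; Inverse)
open import Function.Construct.Composition using (_↔-∘_)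
open import Data.Fin.Permutation using (Permutation′; _⟨$⟩ʳ_)
open import Relation.Binary.PropositionalEquality using (_≡_)

-- Alphabet A_d = Fin d; vertices of the de Bruijn graph B(d,2) are words x₁x₂.
Vertex : ℕ → Set
Vertex d = Fin d × Fin d

Arc : {d : ℕ} → Vertex d → Vertex d → Set
Arc u v = proj₂ u ≡ proj₁ v

record Aut (d : ℕ) : Set where
  field
    perm     : Vertex d ↔ Vertex d
    preserve : ∀ (u v : Vertex d) →
               Arc u v ⇔ Arc (Inverse.to perm u) (Inverse.to perm v)
open Aut public

_∘ᴬ_ : {d : ℕ} → Aut d → Aut d → Aut d
_∘ᴬ_ {d} σ τ = record
  { perm = perm σ ↔-∘ perm τ
  ; preserve = λ u v → record
      { to = λ a → Equivalence.to (preserve σ _ _) (Equivalence.to (preserve τ u v) a)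
      ; from = λ a → Equivalence.from (preserve τ u v) (Equivalence.from (preserve σ _ _) a)
      ; to-cong = λ { _≡_.refl → _≡_.refl }
      ; from-cong = λ { _≡_.refl → _≡_.refl }
      }
  }
  where open import Function.Bundles using (module Equivalence)

_≈ᴬ_ : {d : ℕ} → Aut d → Aut d → Set
σ ≈ᴬ τ = ∀ v → Inverse.to (perm σ) v ≡ Inverse.to (perm τ) v

_∘ˢ_ : {d : ℕ} → Permutation′ d → Permutation′ d → Permutation′ d
π ∘ˢ ρ = π ↔-∘ ρ

_≈ˢ_ : {d : ℕ} → Permutation′ d → Permutation′ d → Set
π ≈ˢ ρ = ∀ i → π ⟨$⟩ʳ i ≡ ρ ⟨$⟩ʳ i

record AutIsoSym (d : ℕ) : Set where
  field
    φ          : Aut d → Permutation′ d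
    φ-cong     : ∀ σ τ → σ ≈ᴬ τ → φ σ ≈ˢ φ τ
    φ-hom      : ∀ σ τ → φ (σ ∘ᴬ τ) ≈ˢ (φ σ ∘ˢ φ τ)
    φ-injective  : ∀ σ τ → φ σ ≈ˢ φ τ → σ ≈ᴬ τ
    φ-surjective : ∀ π → ∃ λ σ → φ σ ≈ˢ π

module Submission where

-- The key observation is that a map F on the vertices of B(d,2) that sends
-- arcs to arcs is a "product map": F(a,b) = (f a , f b) for a single letter
-- map f, read off as f a = first letter of F(a,x₀) for any fixed letter x₀.
-- Indeed the arcs ab → bx₀ and x₀a → ab, x₀a → ax₀ force the second letter
-- of F(ab) to be f b and the first letter to be f a.
--
-- Both directions of an automorphism preserve arcs, so each automorphism σ
-- induces a letter map together with an inverse letter map, i.e. a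
-- permutation φ σ of A_d.  Product form makes φ multiplicative and
-- injective, and every permutation π is hit by the automorphism π × π.

open import Defs
open import Data.Nat using (ℕ; _≤_; suc)
open import Data.Fin using (Fin; zero)
open import Data.Product using (_,_; proj₁; proj₂)
open import Function.Base using (_∘_)
open import Function.Bundles using (Inverse; Injection; mk↔ₛ′; mk⇔; module Equivalence)
open import Function.Properties.Inverse using (Inverse⇒Injection)
open import Data.Product.Function.NonDependent.Propositional using (_×-↔_)
open import Data.Fin.Permutation using (Permutation′)
open import Relation.Binary.PropositionalEquality
  using (_≡_; _≗_; refl; sym; cong; cong₂; subst₂; module ≡-Reasoning)

module _ {d : ℕ} (x₀ : Fin d) where

  ArcPreserving : (Vertex d → Vertex d) → Set
  ArcPreserving F = ∀ u v → Arc u v → Arc (F u) (F v)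

  letter : (Vertex d → Vertex d) → Fin d → Fin d
  letter F a = proj₁ (F (a , x₀))

  product-form : ∀ F → ArcPreserving F → ∀ a b → F (a , b) ≡ (letter F a , letter F b)
  product-form F F-arc a b = cong₂ _,_ first second
    where
      -- arcs x₀a → ab and x₀a → ax₀
      first : proj₁ (F (a , b)) ≡ letter F a
      first = begin
        proj₁ (F (a , b))   ≡⟨ sym (F-arc (x₀ , a) (a , b) refl) ⟩
        proj₂ (F (x₀ , a))  ≡⟨ F-arc (x₀ , a) (a , x₀) refl ⟩
        letter F a          ∎
        where open ≡-Reasoning
      -- arc ab → bx₀
      second : proj₂ (F (a , b)) ≡ letter F b
      second = F-arc (a , b) (b , x₀) refl

  letter-∘ : ∀ F G → ArcPreserving F → ArcPreserving G →
             letter (F ∘ G) ≗ letter F ∘ letter G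
  letter-∘ F G F-arc G-arc a = begin
    proj₁ (F (G (a , x₀)))                   ≡⟨ cong (proj₁ ∘ F) (product-form G G-arc a x₀) ⟩
    proj₁ (F (letter G a , letter G x₀))     ≡⟨ cong proj₁ (product-form F F-arc (letter G a) (letter G x₀)) ⟩
    letter F (letter G a)                    ∎
    where open ≡-Reasoning

  letter-inverse : ∀ F G → ArcPreserving F → ArcPreserving G → (∀ v → F (G v) ≡ v) →
                   ∀ a → letter F (letter G a) ≡ a
  letter-inverse F G F-arc G-arc FG≡id a = begin
    letter F (letter G a)  ≡⟨ sym (letter-∘ F G F-arc G-arc a) ⟩
    letter (F ∘ G) a       ≡⟨ cong proj₁ (FG≡id (a , x₀)) ⟩
    a                      ∎
    where open ≡-Reasoning

  fwd bwd : Aut d → Vertex d → Vertex d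
  fwd σ = Inverse.to (perm σ)
  bwd σ = Inverse.from (perm σ)

  fwd-arc : ∀ σ → ArcPreserving (fwd σ)
  fwd-arc σ u v = Equivalence.to (preserve σ u v)

  -- The inverse preserves arcs because σ reflects them.
  bwd-arc : ∀ σ → ArcPreserving (bwd σ)
  bwd-arc σ u v uv = Equivalence.from (preserve σ (bwd σ u) (bwd σ v))
    (subst₂ Arc (sym (Inverse.strictlyInverseˡ (perm σ) u))
                (sym (Inverse.strictlyInverseˡ (perm σ) v)) uv)

  φ : Aut d → Permutation′ d
  φ σ = mk↔ₛ′ (letter (fwd σ)) (letter (bwd σ))
    (letter-inverse (fwd σ) (bwd σ) (fwd-arc σ) (bwd-arc σ) (Inverse.strictlyInverseˡ (perm σ)))
    (letter-inverse (bwd σ) (fwd σ) (bwd-arc σ) (fwd-arc σ) (Inverse.strictlyInverseʳ (perm σ)))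

  lift : Permutation′ d → Aut d
  lift π = record
    { perm     = π ×-↔ π
    ; preserve = λ u v → mk⇔ (cong (Inverse.to π)) (Injection.injective (Inverse⇒Injection π))
    }

  autIsoSym : AutIsoSym d
  autIsoSym = record
    { φ            = φ
    ; φ-cong       = λ σ τ σ≈τ a → cong proj₁ (σ≈τ (a , x₀))
    ; φ-hom        = λ σ τ → letter-∘ (fwd σ) (fwd τ) (fwd-arc σ) (fwd-arc τ)
    ; φ-injective  = λ σ τ φσ≈φτ (a , b) → begin
        fwd σ (a , b)                            ≡⟨ product-form (fwd σ) (fwd-arc σ) a b ⟩
        (letter (fwd σ) a , letter (fwd σ) b)    ≡⟨ cong₂ _,_ (φσ≈φτ a) (φσ≈φτ b) ⟩
        (letter (fwd τ) a , letter (fwd τ) b)    ≡⟨ sym (product-form (fwd τ) (fwd-arc τ) a b) ⟩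
        fwd τ (a , b)                            ∎
    ; φ-surjective = λ π → lift π , λ a → refl
    }
    where open ≡-Reasoning

lemma4p11 : ∀ (d : ℕ) → 1 ≤ d → AutIsoSym d
lemma4p11 (suc n) _ = autIsoSym zero
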